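{- Let $G$ be a $3$-edge-colorable cubic graph and let $e_1,e_2\in E(G)$. Then $G$ has a nowhere-zero $4$-flow $(D,\phi)$ such that $\phi(f)>0$ for every $f\in E(G)$ and $\phi(e_1)=\phi(e_2)=1$.
   Context: Graphs are finite and may have parallel edges. For an orientation $D$ of $G$, a $\mathbb{Z}$-flow $(D,\phi)$ is a map $\phi:E(G)\to\mathbb{Z}$ such that at every vertex the sum of values on incoming edges equals the sum on outgoing edges. A nowhere-zero $4$-flow is a $\mathbb{Z}$-flow with $0<|\phi(e)|<4$ for every edge $e$. -}

module Defs where

open import Data.Nat using (ℕ)
open import Data.Fin using (Fin)
open import Data.Fin.Properties using (_≟_)
open import Data.Bool using (Bool; true; false; if_then_else_)
open import Data.Product using (_×_; _,_; proj₁; proj₂; Σ; ∃)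
open import Data.List using (List; length; filter; foldr; map; allFin; cartesianProduct)
open import Data.Integer using (ℤ; _+_; -_; +_; _<_; ∣_∣)
import Data.Nat as ℕ
open import Relation.Binary.PropositionalEquality using (_≡_; _≢_)

-- A finite multigraph (parallel edges and loops allowed) with vertex set Fin n
-- and edge set Fin m; each edge has two ends (end true, end false).
record Graph : Set where
  field
    n   : ℕ
    m   : ℕ
    end : Fin m → Bool → Fin n
open Graph public

-- A half-edge (dart): an edge together with a choice of one of its two ends.
Dart : Graph → Set
Dart G = Fin (m G) × Bool

-- The darts incident with vertex v (a loop at v contributes two darts).
dartsAt : (G : Graph) → Fin (n G) → List (Dart G)
dartsAt G v = filter (λ d → end G (proj₁ d) (proj₂ d) ≟ v)
                     (cartesianProduct (allFin (m G)) (true ∷′ false ∷′ []′))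
  where
    open import Data.List using () renaming (_∷_ to _∷′_; [] to []′)

degree : (G : Graph) → Fin (n G) → ℕ
degree G v = length (dartsAt G v)

Cubic : Graph → Set
Cubic G = (v : Fin (n G)) → degree G v ≡ 3

-- A proper 3-edge-colouring: distinct darts at a common vertex receive
-- distinct colours (in particular no loops are allowed).
Proper3EdgeColouring : (G : Graph) → (Fin (m G) → Fin 3) → Set
Proper3EdgeColouring G c =
  (d₁ d₂ : Dart G) → d₁ ≢ d₂ →
  end G (proj₁ d₁) (proj₂ d₁) ≡ end G (proj₁ d₂) (proj₂ d₂) →
  c (proj₁ d₁) ≢ c (proj₁ d₂)

ThreeEdgeColourable : Graph → Set
ThreeEdgeColourable G = Σ (Fin (m G) → Fin 3) (Proper3EdgeColouring G)

-- An orientation D: for each edge e, D e is the end of e that is its head;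
-- the other end (not (D e)) is its tail.
Orientation : Graph → Set
Orientation G = Fin (m G) → Bool

head tail : (G : Graph) → Orientation G → Fin (m G) → Fin (n G)
head G D e = end G e (D e)
tail G D e = end G e (Data.Bool.not (D e))

sumℤ : List ℤ → ℤ
sumℤ = foldr _+_ (+ 0)

inflow outflow : (G : Graph) → Orientation G → (Fin (m G) → ℤ) → Fin (n G) → ℤ
inflow G D φ v =
  sumℤ (map φ (filter (λ e → head G D e ≟ v) (allFin (m G))))
outflow G D φ v =
  sumℤ (map φ (filter (λ e → tail G D e ≟ v) (allFin (m G))))

IsFlow : (G : Graph) → Orientation G → (Fin (m G) → ℤ) → Set
IsFlow G D φ = (v : Fin (n G)) → inflow G D φ v ≡ outflow G D φ v

IsNowhereZeroFlow : (k : ℕ) (G : Graph) → Orientation G → (Fin (m G) → ℤ) → Set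
IsNowhereZeroFlow k G D φ =
  IsFlow G D φ × ((e : Fin (m G)) → (0 ℕ.< ∣ φ e ∣) × (∣ φ e ∣ ℕ.< k))

-- A proper 3-edge-colouring splits G into the even cycles of colours 0 and 2
-- and those of colours 1 and 2.  Choose vertex 2-colourings s and t alternating
-- along these cycles; sending ±1 around every 0-2 cycle and ±2 around every 1-2
-- cycle (signs read off s and t) gives the flow f₁ + 2 f₂, whose values are ±1
-- on colour 0, ±2 on colour 1, and on colour 2 either ±1 (where s ≠ t) or ±3.
-- Orienting each edge along the sign of its value makes the flow positive.
-- Relabelling the colours puts e₁ into colour 0 and e₂ into colour 0 or 2, and
-- complementing t if necessary makes s ≠ t at e₂.
module Submission where

open import Defs
open import Data.Bool using (Bool; true; false; not; if_then_else_; _xor_)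
open import Data.Bool.Properties using (not-involutive; not-¬; xor-assoc; xor-same; not-distribˡ-xor)
  renaming (_≟_ to _≟ᵇ_)
open import Data.Empty using (⊥-elim)
open import Data.Fin using (Fin; zero; suc; toℕ; fromℕ<)
import Data.Fin as Fin
open import Data.Fin.Patterns using (0F; 1F; 2F)
open import Data.Fin.Permutation using (Permutation′; _⟨$⟩ʳ_; transpose; _∘ₚ_)
open import Data.Fin.Properties using (_≟_; _<?_; any?; pigeonhole; toℕ-fromℕ<; <-cmp; <-asym)
open import Data.Integer using (ℤ; +_; -[1+_]; -_; _+_; _-_; _<_; 0ℤ; ∣_∣; +<+)
import Data.Integer.Properties as ℤ
open import Data.Integer.Tactic.RingSolver using (solve-∀)
open import Data.List using ([]; _∷_; map; filter; allFin; cartesianProduct)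
open import Data.List.Membership.Propositional.Properties using (∈-allFin; ∈-map⁻)
open import Data.List.Properties using (map-cong; map-cong-local; map-∘)
open import Data.List.Relation.Binary.Permutation.Propositional as ↭ using (_↭_; ↭-sym; ↭⇒↭ₛ)
open import Data.List.Relation.Binary.Permutation.Propositional.Properties using (∈-resp-↭; map⁺)
open import Data.List.Relation.Binary.Permutation.Setoid.Properties using (foldr-commMonoid)
open import Data.List.Relation.Unary.All as All using (All; []; _∷_)
open import Data.List.Relation.Unary.All.Properties using (all-filter)
open import Data.List.Relation.Unary.AllPairs using ([]; _∷_)
open import Data.List.Relation.Unary.Unique.Propositional using (Unique)
open import Data.List.Relation.Unary.Unique.Propositional.Properties using (filter⁺; cartesianProduct⁺; allFin⁺)
open import Data.Nat using (ℕ; zero; suc; _*_; _%_; _/_; z<s; s<s)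
import Data.Nat as ℕ
open import Data.Nat.DivMod using (m≡m%n+[m/n]*n; m%n<n)
open import Data.Nat.Properties using (+-suc; n<1+n; m≤n⇒∃[o]m+o≡n)
open import Data.Product using (Σ; ∃; _×_; _,_; proj₁; proj₂)
open import Data.Product.Properties using (≡-dec)
open import Function using (_∘_)
open import Function.Bundles using (Injection)
open import Function.Definitions using (Injective)
open import Function.Properties.Inverse using (↔⇒↣)
open import Level using (0ℓ)
open import Relation.Binary using (tri<; tri≈; tri>)
open import Relation.Binary.PropositionalEquality
  using (_≡_; _≢_; refl; sym; trans; cong; cong₂; subst; module ≡-Reasoning)
import Relation.Binary.PropositionalEquality as ≡
open import Relation.Nullary using (¬_; Dec; yes; no; does)
open import Relation.Nullary.Decidable using (map′; dec-true; dec-false)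
open import Relation.Unary using (Pred; Decidable)

iterate : ∀ {A : Set} → (A → A) → ℕ → A → A
iterate f zero    x = x
iterate f (suc k) x = f (iterate f k x)

module Orbits {n : ℕ} (f : Fin n → Fin n) (f-injective : Injective _≡_ _≡_ f) where

  infix 4 _↝_

  _↝_ : Fin n → Fin n → Set
  u ↝ v = ∃ λ k → iterate f k u ≡ v

  iterate-+ : ∀ j k v → iterate f (j ℕ.+ k) v ≡ iterate f j (iterate f k v)
  iterate-+ zero    k v = refl
  iterate-+ (suc j) k v = cong f (iterate-+ j k v)

  iterate-injective : ∀ k {u v} → iterate f k u ≡ iterate f k v → u ≡ v
  iterate-injective zero    eq = eq
  iterate-injective (suc k) eq = iterate-injective k (f-injective eq)

  -- Pigeonhole on v, f v, …, fⁿ v yields fⁱ v ≡ fʲ v with i < j; cancel fⁱ.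
  period : ∀ v → ∃ λ p → iterate f (suc p) v ≡ v
  period v with pigeonhole (n<1+n n) (λ i → iterate f (toℕ i) v)
  ... | i , j , i<j , fⁱv≡fʲv with m≤n⇒∃[o]m+o≡n i<j
  ... | o , i+1+o≡j = o , iterate-injective (toℕ i) (begin
    iterate f (toℕ i) (iterate f (suc o) v) ≡⟨ iterate-+ (toℕ i) (suc o) v ⟨
    iterate f (toℕ i ℕ.+ suc o) v           ≡⟨ cong (λ k → iterate f k v) (trans (+-suc (toℕ i) o) i+1+o≡j) ⟩
    iterate f (toℕ j) v                     ≡⟨ fⁱv≡fʲv ⟨
    iterate f (toℕ i) v                     ∎)
    where open ≡-Reasoning

  iterate-comm : ∀ k v → iterate f k (f v) ≡ f (iterate f k v)
  iterate-comm zero    v = refl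
  iterate-comm (suc k) v = cong f (iterate-comm k v)

  iterate-multiple : ∀ {p v} → iterate f (suc p) v ≡ v → ∀ q → iterate f (q * suc p) v ≡ v
  iterate-multiple         fᵖv≡v zero    = refl
  iterate-multiple {p} {v} fᵖv≡v (suc q) =
    trans (iterate-+ (suc p) (q * suc p) v) (trans (cong (iterate f (suc p)) (iterate-multiple fᵖv≡v q)) fᵖv≡v)

  iterate-mod : ∀ {p v} → iterate f (suc p) v ≡ v → ∀ k → iterate f (k % suc p) v ≡ iterate f k v
  iterate-mod {p} {v} fᵖv≡v k = begin
    iterate f (k % suc p) v
      ≡⟨ cong (iterate f (k % suc p)) (iterate-multiple fᵖv≡v (k / suc p)) ⟨
    iterate f (k % suc p) (iterate f (k / suc p * suc p) v)
      ≡⟨ iterate-+ (k % suc p) (k / suc p * suc p) v ⟨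
    iterate f (k % suc p ℕ.+ k / suc p * suc p) v
      ≡⟨ cong (λ j → iterate f j v) (m≡m%n+[m/n]*n k (suc p)) ⟨
    iterate f k v
      ∎
    where open ≡-Reasoning

  ↝-refl : ∀ {v} → v ↝ v
  ↝-refl = 0 , refl

  ↝-trans : ∀ {u v w} → u ↝ v → v ↝ w → u ↝ w
  ↝-trans {u} (j , fʲu≡v) (k , fᵏv≡w) = k ℕ.+ j , trans (iterate-+ k j u) (trans (cong (iterate f k) fʲu≡v) fᵏv≡w)

  ↝-step⁻¹ : ∀ v → f v ↝ v
  ↝-step⁻¹ v with p , fᵖv≡v ← period v = p , trans (iterate-comm p v) fᵖv≡v

  ↝-sym : ∀ {u v} → u ↝ v → v ↝ u
  ↝-sym     (zero  , refl) = ↝-refl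
  ↝-sym {u} (suc k , refl) = ↝-trans (↝-step⁻¹ (iterate f k u)) (↝-sym (k , refl))

  _↝?_ : ∀ u v → Dec (u ↝ v)
  u ↝? v with p , fᵖu≡u ← period u =
    map′ (λ (i , fⁱu≡v) → toℕ i , fⁱu≡v)
         (λ (k , fᵏu≡v) → fromℕ< (m%n<n k (suc p)) ,
            trans (cong (λ j → iterate f j u) (toℕ-fromℕ< (m%n<n k (suc p))))
                  (trans (iterate-mod fᵖu≡u k) fᵏu≡v))
         (any? (λ i → iterate f (toℕ i) u ≟ v))

module _ {n : ℕ} where

  Least : (P : Pred (Fin n) 0ℓ) → Fin n → Set
  Least P i = P i × (∀ {j} → j Fin.< i → ¬ P j)

  least-unique : ∀ {P : Pred (Fin n) 0ℓ} {i j} → Least P i → Least P j → i ≡ j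
  least-unique {i = i} {j} (Pi , i-least) (Pj , j-least) with <-cmp i j
  ... | tri< i<j _ _ = ⊥-elim (j-least i<j Pi)
  ... | tri≈ _ i≡j _ = i≡j
  ... | tri> _ _ j<i = ⊥-elim (i-least j<i Pj)

  least-cong : ∀ {P Q : Pred (Fin n) 0ℓ} → (∀ i → P i → Q i) → (∀ i → Q i → P i) →
               ∀ {i} → Least P i → Least Q i
  least-cong P⇒Q Q⇒P (Pi , i-least) = P⇒Q _ Pi , λ j<i Qj → i-least j<i (Q⇒P _ Qj)

least : ∀ {n} {P : Pred (Fin n) 0ℓ} → Decidable P → ∃ P → ∃ (Least P)
least {suc n} P? (i , Pi) with P? zero | i
... | yes P0 | _     = zero , P0 , λ ()
... | no ¬P0 | zero  = ⊥-elim (¬P0 Pi)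
... | no ¬P0 | suc i with j , Pj , j-least ← least (P? ∘ suc) (i , Pi) =
  suc j , Pj , λ { {zero} _ → ¬P0 ; {suc k} (s<s k<j) → j-least k<j }

<?-swap : ∀ {n} {i j : Fin n} → i ≢ j → does (j <? i) ≡ not (does (i <? j))
<?-swap {i = i} {j} i≢j with <-cmp i j
... | tri< i<j _ _ rewrite dec-true (i <? j) i<j = dec-false (j <? i) (<-asym i<j)
... | tri≈ _ i≡j _ = ⊥-elim (i≢j i≡j)
... | tri> _ _ j<i rewrite dec-false (i <? j) (<-asym j<i) = dec-true (j <? i) j<i

-- The α,γ-cycles are the orbits of π = γ ∘ α together with their α-images;
-- v is coloured by comparing the least element of its π-orbit with that of the
-- π-orbit of α v.
module Alternating {n : ℕ} (α γ : Fin n → Fin n)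
    (α-involutive : ∀ v → α (α v) ≡ v) (γ-involutive : ∀ v → γ (γ v) ≡ v)
    (α-fixpointFree : ∀ v → α v ≢ v) (γ-fixpointFree : ∀ v → γ v ≢ v) where

  π : Fin n → Fin n
  π = γ ∘ α

  π-injective : Injective _≡_ _≡_ π
  π-injective {u} {v} γαu≡γαv = begin
    u         ≡⟨ α-involutive u ⟨
    α (α u)   ≡⟨ cong α (trans (sym (γ-involutive (α u))) (trans (cong γ γαu≡γαv) (γ-involutive (α v)))) ⟩
    α (α v)   ≡⟨ α-involutive v ⟩
    v         ∎
    where open ≡-Reasoning

  open Orbits π π-injective

  -- Parity: α⁻¹ π α = π⁻¹, so πᵏ⁺² v ≡ α v turns into πᵏ (π v) ≡ α (π v).
  iterate≢α : ∀ k v → iterate π k v ≢ α v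
  iterate≢α zero          v v≡αv   = α-fixpointFree v (sym v≡αv)
  iterate≢α (suc zero)    v πv≡αv  = γ-fixpointFree (α v) πv≡αv
  iterate≢α (suc (suc k)) v πᵏ⁺²v≡αv =
    iterate≢α k (π v) (trans (iterate-comm k v) (unπ πᵏ⁺²v≡αv))
    where
      unπ : ∀ {w} → π w ≡ α v → w ≡ α (π v)
      unπ {w} πw≡αv = trans (sym (α-involutive w))
        (cong α (trans (sym (γ-involutive (α w))) (cong γ πw≡αv)))

  α-outside-orbit : ∀ v → ¬ (v ↝ α v)
  α-outside-orbit v (k , πᵏv≡αv) = iterate≢α k v πᵏv≡αv

  orbitMin : Fin n → Fin n
  orbitMin v = proj₁ (least (_↝? v) (v , ↝-refl))

  orbitMin-least : ∀ v → Least (_↝ v) (orbitMin v)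
  orbitMin-least v = proj₂ (least (_↝? v) (v , ↝-refl))

  orbitMin-cong : ∀ {u v} → u ↝ v → orbitMin u ≡ orbitMin v
  orbitMin-cong u↝v = least-unique
    (least-cong (λ _ w↝u → ↝-trans w↝u u↝v) (λ _ w↝v → ↝-trans w↝v (↝-sym u↝v)) (orbitMin-least _))
    (orbitMin-least _)

  orbitMin-α : ∀ v → orbitMin v ≢ orbitMin (α v)
  orbitMin-α v eq = α-outside-orbit v (↝-trans (↝-sym r↝v) r↝αv)
    where
      r↝v  = proj₁ (orbitMin-least v)
      r↝αv = subst (_↝ α v) (sym eq) (proj₁ (orbitMin-least (α v)))

  colour : Fin n → Bool
  colour v = does (orbitMin v <? orbitMin (α v))

  colour-α : ∀ v → colour (α v) ≡ not (colour v)
  colour-α v rewrite α-involutive v = <?-swap (orbitMin-α v)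

  colour-γ : ∀ v → colour (γ v) ≡ not (colour v)
  colour-γ v = begin
    does (orbitMin (γ v) <? orbitMin (α (γ v)))
      ≡⟨ cong₂ (λ i j → does (i <? j)) (sym (orbitMin-cong αv↝γv)) (orbitMin-cong αγv↝v) ⟩
    does (orbitMin (α v) <? orbitMin v)
      ≡⟨ <?-swap (orbitMin-α v) ⟩
    not (colour v)
      ∎
    where
      open ≡-Reasoning
      αv↝γv : α v ↝ γ v
      αv↝γv = 1 , cong γ (α-involutive v)
      αγv↝v : α (γ v) ↝ v
      αγv↝v = 1 , trans (cong γ (α-involutive (γ v))) (γ-involutive v)

when : Bool → ℤ → ℤ
when b z = if b then z else 0ℤ

signed : Bool → ℤ → ℤ
signed true  z = z
signed false z = - z

signed-not : ∀ b z → signed (not b) z ≡ - signed b z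
signed-not true  z = refl
signed-not false z = sym (ℤ.neg-involutive z)

orientOf : ℤ → Bool
orientOf (+ _)    = true
orientOf -[1+ _ ] = false

signed-orientOf : ∀ z → signed (orientOf z) (+ ∣ z ∣) ≡ z
signed-orientOf (+ _)    = refl
signed-orientOf -[1+ _ ] = refl

sumℤ-map-filter : ∀ {A : Set} {P : Pred A 0ℓ} (P? : Decidable P) (f : A → ℤ) xs →
  sumℤ (map f (filter P? xs)) ≡ sumℤ (map (λ x → when (does (P? x)) (f x)) xs)
sumℤ-map-filter P? f []       = refl
sumℤ-map-filter P? f (x ∷ xs) with does (P? x)
... | true  = cong (λ s → f x + s) (sumℤ-map-filter P? f xs)
... | false = trans (sumℤ-map-filter P? f xs) (sym (ℤ.+-identityˡ _))

sumℤ-map-- : ∀ {A : Set} (f g : A → ℤ) xs →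
  sumℤ (map f xs) - sumℤ (map g xs) ≡ sumℤ (map (λ x → f x - g x) xs)
sumℤ-map-- f g []       = refl
sumℤ-map-- f g (x ∷ xs) = trans (interchange (f x) _ (g x) _) (cong (λ s → f x - g x + s) (sumℤ-map-- f g xs))
  where
    interchange : ∀ a A b B → (a + A) - (b + B) ≡ (a - b) + (A - B)
    interchange = solve-∀

sumℤ-map-pairs : ∀ {A : Set} (h : A × Bool → ℤ) xs →
  sumℤ (map h (cartesianProduct xs (true ∷ false ∷ []))) ≡ sumℤ (map (λ x → h (x , true) + h (x , false)) xs)
sumℤ-map-pairs h []       = refl
sumℤ-map-pairs h (x ∷ xs) =
  trans (sym (ℤ.+-assoc (h (x , true)) (h (x , false)) _))
        (cong (λ s → h (x , true) + h (x , false) + s) (sumℤ-map-pairs h xs))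

sumℤ-↭ : ∀ {xs ys} → xs ↭ ys → sumℤ xs ≡ sumℤ ys
sumℤ-↭ xs↭ys = foldr-commMonoid (≡.setoid ℤ) ℤ.+-0-isCommutativeMonoid (↭⇒↭ₛ xs↭ys)

-- One edge's share of the net inflow at a vertex w: a and b say whether its
-- ends true and false are w, and o is the end it points to.
reorient : ∀ o a b z →
  when (if o then a else b) z - when (if o then b else a) z ≡ when a (signed o z) + when b (- signed o z)
reorient true  a     true  z = refl
reorient true  a     false z = refl
reorient false true  true  z = trans (ℤ.+-comm z (- z)) (cong (λ s → - z + s) (sym (ℤ.neg-involutive z)))
reorient false true  false z = ℤ.+-comm 0ℤ (- z)
reorient false false true  z = trans (ℤ.+-comm z 0ℤ) (cong (λ s → 0ℤ + s) (sym (ℤ.neg-involutive z)))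
reorient false false false z = refl

-- ψ is the flow (D, φ) relative to the orientation in which every edge points
-- to its end true.
net-inflow : ∀ (G : Graph) (D : Orientation G) (φ ψ : Fin (m G) → ℤ) →
  (∀ e → ψ e ≡ signed (D e) (φ e)) → ∀ v →
  inflow G D φ v - outflow G D φ v ≡ sumℤ (map (λ (e , b) → signed b (ψ e)) (dartsAt G v))
net-inflow G D φ ψ ψ≡±φ v = begin
  inflow G D φ v - outflow G D φ v
    ≡⟨ cong₂ _-_ (sumℤ-map-filter (λ e → head G D e ≟ v) φ edges)
                 (sumℤ-map-filter (λ e → tail G D e ≟ v) φ edges) ⟩
  sumℤ (map (λ e → at? (head G D e) (φ e)) edges) - sumℤ (map (λ e → at? (tail G D e) (φ e)) edges)
    ≡⟨ sumℤ-map-- _ _ edges ⟩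
  sumℤ (map (λ e → at? (head G D e) (φ e) - at? (tail G D e) (φ e)) edges)
    ≡⟨ cong sumℤ (map-cong per-edge edges) ⟩
  sumℤ (map (λ e → at? (end G e true) (ψ e) + at? (end G e false) (- ψ e)) edges)
    ≡⟨ sumℤ-map-pairs (λ (e , b) → at? (end G e b) (signed b (ψ e))) edges ⟨
  sumℤ (map (λ (e , b) → at? (end G e b) (signed b (ψ e))) darts)
    ≡⟨ sumℤ-map-filter (λ (e , b) → end G e b ≟ v) (λ (e , b) → signed b (ψ e)) darts ⟨
  sumℤ (map (λ (e , b) → signed b (ψ e)) (dartsAt G v))
    ∎
  where
    open ≡-Reasoning
    edges = allFin (m G)
    darts = cartesianProduct edges (true ∷ false ∷ [])
    at? : Fin (n G) → ℤ → ℤ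
    at? w = when (does (w ≟ v))
    per-edge : ∀ e → at? (head G D e) (φ e) - at? (tail G D e) (φ e)
                   ≡ at? (end G e true) (ψ e) + at? (end G e false) (- ψ e)
    per-edge e rewrite ψ≡±φ e with D e
    ... | true  = reorient true  (does (end G e true ≟ v)) (does (end G e false ≟ v)) (φ e)
    ... | false = reorient false (does (end G e true ≟ v)) (does (end G e false ≟ v)) (φ e)

-- Ψ c S T is the value entering a vertex along its edge of colour c, when the
-- vertex has sides S and T in the bipartitions of the 0-2 and 1-2 cycles:
-- f₁ + 2 f₂ for the 2-flows f₁, f₂ circulating around these cycles.
Ψ : Fin 3 → Bool → Bool → ℤ
Ψ 0F S T = signed S (+ 1)
Ψ 1F S T = signed T (+ 2)
Ψ 2F S T = - (signed S (+ 1) + signed T (+ 2))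

Ψ-2F-not : ∀ S T → Ψ 2F (not S) (not T) ≡ - Ψ 2F S T
Ψ-2F-not true  true  = refl
Ψ-2F-not true  false = refl
Ψ-2F-not false true  = refl
Ψ-2F-not false false = refl

Ψ-sum : ∀ S T → sumℤ (map (λ c → Ψ c S T) (allFin 3)) ≡ 0ℤ
Ψ-sum S T = cancel (signed S (+ 1)) (signed T (+ 2))
  where
    cancel : ∀ x y → x + (y + (- (x + y) + 0ℤ)) ≡ 0ℤ
    cancel = solve-∀

Ψ-bounded : ∀ c S T → 0 ℕ.< ∣ Ψ c S T ∣ × ∣ Ψ c S T ∣ ℕ.< 4
Ψ-bounded 0F true  _     = z<s , s<s z<s
Ψ-bounded 0F false _     = z<s , s<s z<s
Ψ-bounded 1F _     true  = z<s , s<s (s<s z<s)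
Ψ-bounded 1F _     false = z<s , s<s (s<s z<s)
Ψ-bounded 2F true  true  = z<s , s<s (s<s (s<s z<s))
Ψ-bounded 2F true  false = z<s , s<s z<s
Ψ-bounded 2F false true  = z<s , s<s z<s
Ψ-bounded 2F false false = z<s , s<s (s<s (s<s z<s))

Ψ-0F-unit : ∀ S T → ∣ Ψ 0F S T ∣ ≡ 1
Ψ-0F-unit true  _ = refl
Ψ-0F-unit false _ = refl

Ψ-2F-unit : ∀ S → ∣ Ψ 2F S (not S) ∣ ≡ 1
Ψ-2F-unit true  = refl
Ψ-2F-unit false = refl

distinct-↭-allFin : ∀ {a b c : Fin 3} → a ≢ b → a ≢ c → b ≢ c → a ∷ b ∷ c ∷ [] ↭ allFin 3
distinct-↭-allFin {0F} {1F} {2F} _ _ _ = ↭.refl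
distinct-↭-allFin {0F} {2F} {1F} _ _ _ = ↭.prep 0F (↭.swap 2F 1F ↭.refl)
distinct-↭-allFin {1F} {0F} {2F} _ _ _ = ↭.swap 1F 0F ↭.refl
distinct-↭-allFin {1F} {2F} {0F} _ _ _ = ↭.trans (↭.prep 1F (↭.swap 2F 0F ↭.refl)) (↭.swap 1F 0F ↭.refl)
distinct-↭-allFin {2F} {0F} {1F} _ _ _ = ↭.trans (↭.swap 2F 0F ↭.refl) (↭.prep 0F (↭.swap 2F 1F ↭.refl))
distinct-↭-allFin {2F} {1F} {0F} _ _ _ =
  ↭.trans (↭.swap 2F 1F ↭.refl) (↭.trans (↭.prep 1F (↭.swap 2F 0F ↭.refl)) (↭.swap 1F 0F ↭.refl))
distinct-↭-allFin {0F} {0F} a≢b _ _ = ⊥-elim (a≢b refl)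
distinct-↭-allFin {1F} {1F} a≢b _ _ = ⊥-elim (a≢b refl)
distinct-↭-allFin {2F} {2F} a≢b _ _ = ⊥-elim (a≢b refl)
distinct-↭-allFin {0F} {_} {0F} _ a≢c _ = ⊥-elim (a≢c refl)
distinct-↭-allFin {1F} {_} {1F} _ a≢c _ = ⊥-elim (a≢c refl)
distinct-↭-allFin {2F} {_} {2F} _ a≢c _ = ⊥-elim (a≢c refl)
distinct-↭-allFin {_} {0F} {0F} _ _ b≢c = ⊥-elim (b≢c refl)
distinct-↭-allFin {_} {1F} {1F} _ _ b≢c = ⊥-elim (b≢c refl)
distinct-↭-allFin {_} {2F} {2F} _ _ b≢c = ⊥-elim (b≢c refl)

module _ (G : Graph) where

  at : Dart G → Fin (n G)
  at d = end G (proj₁ d) (proj₂ d)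

  opposite : Dart G → Dart G
  opposite (e , b) = e , not b

  at-dartsAt : ∀ v → All (λ d → at d ≡ v) (dartsAt G v)
  at-dartsAt v = all-filter (λ d → at d ≟ v) (cartesianProduct (allFin (m G)) (true ∷ false ∷ []))

  dartsAt-unique : ∀ v → Unique (dartsAt G v)
  dartsAt-unique v = filter⁺ (λ d → at d ≟ v) (cartesianProduct⁺ (allFin⁺ (m G)) (((λ ()) ∷ []) ∷ [] ∷ []))

  opposite≢ : ∀ d → opposite d ≢ d
  opposite≢ (e , b) eq = not-¬ refl (sym (cong proj₂ eq))

module ProperColouring (G : Graph) (cubic : Cubic G)
    (col : Fin (m G) → Fin 3) (proper : Proper3EdgeColouring G col) where

  dartColour : Dart G → Fin 3
  dartColour d = col (proj₁ d)

  dart-unique : ∀ {d d′} → at G d ≡ at G d′ → dartColour d ≡ dartColour d′ → d ≡ d′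
  dart-unique {d} {d′} same-end same-colour with ≡-dec _≟_ _≟ᵇ_ d d′
  ... | yes d≡d′ = d≡d′
  ... | no  d≢d′ = ⊥-elim (proper d d′ d≢d′ same-end same-colour)

  coloursAt-↭ : ∀ v → map dartColour (dartsAt G v) ↭ allFin 3
  coloursAt-↭ v with dartsAt G v | cubic v | at-dartsAt G v | dartsAt-unique G v
  ... | d₁ ∷ d₂ ∷ d₃ ∷ [] | refl | a₁ ∷ a₂ ∷ a₃ ∷ [] | (d₁≢d₂ ∷ d₁≢d₃ ∷ []) ∷ (d₂≢d₃ ∷ []) ∷ [] ∷ [] =
    distinct-↭-allFin (proper d₁ d₂ d₁≢d₂ (trans a₁ (sym a₂)))
                      (proper d₁ d₃ d₁≢d₃ (trans a₁ (sym a₃)))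
                      (proper d₂ d₃ d₂≢d₃ (trans a₂ (sym a₃)))

  dartOfColour : ∀ v k → ∃ λ d → at G d ≡ v × dartColour d ≡ k
  dartOfColour v k with d , d∈ , k≡ ← ∈-map⁻ dartColour (∈-resp-↭ (↭-sym (coloursAt-↭ v)) (∈-allFin k)) =
    d , All.lookup (at-dartsAt G v) d∈ , sym k≡

  dartOf : Fin (n G) → Fin 3 → Dart G
  dartOf v k = proj₁ (dartOfColour v k)

  neighbour : Fin 3 → Fin (n G) → Fin (n G)
  neighbour k v = at G (opposite G (dartOf v k))

  neighbour-dart : ∀ {k} d → dartColour d ≡ k → neighbour k (at G d) ≡ at G (opposite G d)
  neighbour-dart {k} d colour≡k = cong (at G ∘ opposite G) (dart-unique at≡ (trans colour′≡k (sym colour≡k)))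
    where
      at≡       = proj₁ (proj₂ (dartOfColour (at G d) k))
      colour′≡k = proj₂ (proj₂ (dartOfColour (at G d) k))

  neighbour-involutive : ∀ k v → neighbour k (neighbour k v) ≡ v
  neighbour-involutive k v =
    trans (neighbour-dart (e , not b) colour≡k) (trans (cong (end G e) (not-involutive b)) at≡v)
    where
      e = proj₁ (dartOf v k)
      b = proj₂ (dartOf v k)
      at≡v     = proj₁ (proj₂ (dartOfColour v k))
      colour≡k = proj₂ (proj₂ (dartOfColour v k))

  neighbour-fixpointFree : ∀ k v → neighbour k v ≢ v
  neighbour-fixpointFree k v nv≡v =
    proper (opposite G d) d (opposite≢ G d) (trans nv≡v (sym (proj₁ (proj₂ (dartOfColour v k))))) refl
    where d = dartOf v k

  sum-over-dartsAt : ∀ v (F : Fin 3 → ℤ) → sumℤ (map (F ∘ dartColour) (dartsAt G v)) ≡ sumℤ (map F (allFin 3))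
  sum-over-dartsAt v F = trans (cong sumℤ (map-∘ (dartsAt G v))) (sumℤ-↭ (map⁺ F (coloursAt-↭ v)))

  Alternates : Fin 3 → (Fin (n G) → Bool) → Set
  Alternates k f = ∀ v → f (neighbour k v) ≡ not (f v)

  module Bipartition (k l : Fin 3) = Alternating (neighbour k) (neighbour l)
    (neighbour-involutive k) (neighbour-involutive l) (neighbour-fixpointFree k) (neighbour-fixpointFree l)

  alternates-xor : ∀ {k f} → Alternates k f → ∀ b → Alternates k (λ v → f v xor b)
  alternates-xor {k} {f} f-alt b v = trans (cong (_xor b) (f-alt v)) (sym (not-distribˡ-xor (f v) b))

  end-false : ∀ e → end G e false ≡ neighbour (col e) (end G e true)
  end-false e = sym (neighbour-dart (e , true) refl)

  module FourFlow (s t : Fin (n G) → Bool)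
      (s-alternates₀ : Alternates 0F s) (s-alternates₂ : Alternates 2F s)
      (t-alternates₁ : Alternates 1F t) (t-alternates₂ : Alternates 2F t) where

    value : Dart G → ℤ
    value d = Ψ (dartColour d) (s (at G d)) (t (at G d))

    Ψ-neighbour : ∀ c w → Ψ c (s (neighbour c w)) (t (neighbour c w)) ≡ - Ψ c (s w) (t w)
    Ψ-neighbour 0F w rewrite s-alternates₀ w = signed-not (s w) (+ 1)
    Ψ-neighbour 1F w rewrite t-alternates₁ w = signed-not (t w) (+ 2)
    Ψ-neighbour 2F w rewrite s-alternates₂ w | t-alternates₂ w = Ψ-2F-not (s w) (t w)

    ψ : Fin (m G) → ℤ
    ψ e = value (e , true)

    signed-ψ : ∀ d → signed (proj₂ d) (ψ (proj₁ d)) ≡ value d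
    signed-ψ (e , true)  = refl
    signed-ψ (e , false) = sym (trans (cong (λ w → Ψ (col e) (s w) (t w)) (end-false e)) (Ψ-neighbour (col e) (end G e true)))

    orientation : Orientation G
    orientation e = orientOf (ψ e)

    φ : Fin (m G) → ℤ
    φ e = + ∣ ψ e ∣

    conservation : IsFlow G orientation φ
    conservation v = ℤ.i-j≡0⇒i≡j _ _ (begin
      inflow G orientation φ v - outflow G orientation φ v
        ≡⟨ net-inflow G orientation φ ψ (λ e → sym (signed-orientOf (ψ e))) v ⟩
      sumℤ (map (λ (e , b) → signed b (ψ e)) (dartsAt G v))
        ≡⟨ cong sumℤ (map-cong signed-ψ (dartsAt G v)) ⟩
      sumℤ (map value (dartsAt G v))
        ≡⟨ cong sumℤ (map-cong-local (All.map (λ {d} → cong (λ w → Ψ (dartColour d) (s w) (t w))) (at-dartsAt G v))) ⟩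
      sumℤ (map ((λ c → Ψ c (s v) (t v)) ∘ dartColour) (dartsAt G v))
        ≡⟨ sum-over-dartsAt v (λ c → Ψ c (s v) (t v)) ⟩
      sumℤ (map (λ c → Ψ c (s v) (t v)) (allFin 3))
        ≡⟨ Ψ-sum (s v) (t v) ⟩
      0ℤ
        ∎)
      where open ≡-Reasoning

    nowhereZero : IsNowhereZeroFlow 4 G orientation φ
    nowhereZero = conservation , λ e → Ψ-bounded (col e) _ _

    φ-positive : ∀ e → + 0 < φ e
    φ-positive e = +<+ (proj₁ (Ψ-bounded (col e) _ _))

    φ-0F : ∀ e → col e ≡ 0F → φ e ≡ + 1
    φ-0F e col≡0 = cong +_ (trans (cong (λ c → ∣ Ψ c S T ∣) col≡0) (Ψ-0F-unit S T))
      where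
        S = s (end G e true)
        T = t (end G e true)

    φ-unit : ∀ e → col e ≢ 1F → t (end G e true) ≡ not (s (end G e true)) → φ e ≡ + 1
    φ-unit e col≢1 t≡¬s with col e
    ... | 0F = cong +_ (Ψ-0F-unit (s (end G e true)) (t (end G e true)))
    ... | 1F = ⊥-elim (col≢1 refl)
    ... | 2F = cong +_ (trans (cong (λ T → ∣ Ψ 2F (s (end G e true)) T ∣) t≡¬s) (Ψ-2F-unit (s (end G e true))))

transpose-0F : ∀ (a : Fin 3) → transpose 0F a ⟨$⟩ʳ a ≡ 0F
transpose-0F 0F = refl
transpose-0F 1F = refl
transpose-0F 2F = refl

recolouring : ∀ (a b : Fin 3) → ∃ λ (σ : Permutation′ 3) → σ ⟨$⟩ʳ a ≡ 0F × σ ⟨$⟩ʳ b ≢ 1F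
recolouring a b with transpose 0F a ⟨$⟩ʳ b ≟ 1F
... | no  τb≢1 = transpose 0F a , transpose-0F a , τb≢1
... | yes τb≡1 = transpose 0F a ∘ₚ transpose 1F 2F , cong (transpose 1F 2F ⟨$⟩ʳ_) (transpose-0F a) ,
                 λ σb≡1 → 2F≢1F (trans (cong (transpose 1F 2F ⟨$⟩ʳ_) (sym τb≡1)) σb≡1)
  where
    2F≢1F : 2F ≢ 1F
    2F≢1F ()

recolouring-proper : ∀ {G c} (σ : Permutation′ 3) →
                     Proper3EdgeColouring G c → Proper3EdgeColouring G ((σ ⟨$⟩ʳ_) ∘ c)
recolouring-proper σ proper d₁ d₂ d₁≢d₂ same-end = proper d₁ d₂ d₁≢d₂ same-end ∘ Injection.injective (↔⇒↣ σ)

mainTheorem15 : (G : Graph) → Cubic G → ThreeEdgeColourable G →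
    (e₁ e₂ : Fin (m G)) →
    Σ (Orientation G) (λ D → Σ (Fin (m G) → ℤ) (λ φ →
      IsNowhereZeroFlow 4 G D φ
      × ((f : Fin (m G)) → + 0 < φ f)
      × φ e₁ ≡ + 1 × φ e₂ ≡ + 1))
mainTheorem15 G cubic (c , proper) e₁ e₂ with σ , σce₁≡0 , σce₂≢1 ← recolouring (c e₁) (c e₂) =
  orientation , φ , nowhereZero , φ-positive , φ-0F e₁ σce₁≡0 , φ-unit e₂ σce₂≢1 t-u
  where
    open ProperColouring G cubic ((σ ⟨$⟩ʳ_) ∘ c) (recolouring-proper σ proper)
    module S = Bipartition 0F 2F
    module T = Bipartition 1F 2F
    u = end G e₂ true
    flipT : Bool
    flipT = T.colour u xor not (S.colour u)
    t : Fin (n G) → Bool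
    t v = T.colour v xor flipT
    open FourFlow S.colour t S.colour-α S.colour-γ (alternates-xor T.colour-α flipT) (alternates-xor T.colour-γ flipT)
    t-u : t u ≡ not (S.colour u)
    t-u = trans (sym (xor-assoc (T.colour u) (T.colour u) (not (S.colour u))))
                (cong (_xor not (S.colour u)) (xor-same (T.colour u)))
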